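{- Let $G$ be a connected chordal graph, $K^\star$ a maximal clique of $G$, and consider the layer structure of $C(G)$ rooted by $K^\star$. Let $UU'$ be an edge of the layer structure with label $S$. Then every path between $U$ and $U'$ in the layer structure contains an edge whose label is $S$.
   Context: Graphs are finite, simple, undirected; chordal means no induced cycle of length greater than three. A $u$-$v$ separator of $G$ is a set $X\subseteq V(G)$ with $u,v$ in different components of $G-X$; it is minimal if no proper subset is one. The clique graph $C(G)$ has as nodes the maximal cliques of $G$; distinct nodes $K,K'$ are adjacent iff $K\cap K'$ is a minimal $u$-$v$ separator of $G$ for all $u\in K\setminus K'$, $v\in K'\setminus K$; edge $KK'$ has label $K\cap K'$ and weight $|K\cap K'|$. Units are the connected components of $C(G)$ after deleting all edges of minimum weight (the minimum edge weight of $C(G)$). An edge of $C(G)$ crosses units $U,U'$ if its endpoints lie one in each. The layer structure of $C(G)$ rooted by $K^\star$ is the graph whose vertices are the units, with $U,U'$ adjacent iff some edge of $C(G)$ crosses them; the label of the edge $UU'$ is $K\cap K'$ for any edge $KK'$ of $C(G)$ crossing $U,U'$ (all such edges have the same label). The root is the unit containing $K^\star$. -}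

module Defs where

open import Data.Nat using (ℕ; zero; suc; _<_; _≤_)
open import Data.Fin using (Fin; zero; suc; toℕ; inject₁; fromℕ)
open import Data.Fin.Subset using (Subset; _∈_; _∉_; _⊆_; _⊂_; _∩_; _─_; ∣_∣; ⊥)
open import Data.Product using (Σ; ∃; ∃-syntax; _×_; _,_)
open import Data.Sum using (_⊎_)
open import Relation.Nullary using (¬_)
open import Relation.Binary.PropositionalEquality using (_≡_; _≢_)

record Graph (n : ℕ) : Set₁ where
  field
    Adj    : Fin n → Fin n → Set
    sym    : ∀ {u v} → Adj u v → Adj v u
    irrefl : ∀ {u} → ¬ Adj u u

open Graph public

module _ {n : ℕ} (G : Graph n) where

  data Reach (X : Subset n) : Fin n → Fin n → Set where
    here : ∀ {u} → u ∉ X → Reach X u u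
    step : ∀ {u w v} → u ∉ X → Adj G u w → Reach X w v → Reach X u v

  Connected : Set
  Connected = ∀ u v → Reach ⊥ u v

  -- Chordality: no induced cycle of length greater than three.
  -- Positions i, j of Fin k are cyclically consecutive.
  Succ : (k : ℕ) → Fin k → Fin k → Set
  Succ k i j = (suc (toℕ i) ≡ toℕ j) ⊎ ((suc (toℕ i) ≡ k) × (toℕ j ≡ 0))

  Consecutive : (k : ℕ) → Fin k → Fin k → Set
  Consecutive k i j = Succ k i j ⊎ Succ k j i

  InducedCycle : (k : ℕ) → (Fin k → Fin n) → Set
  InducedCycle k c =
    (∀ i j → c i ≡ c j → i ≡ j) ×
    (∀ i j → (Adj G (c i) (c j) → Consecutive k i j) × (Consecutive k i j → Adj G (c i) (c j)))

  Chordal : Set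
  Chordal = ∀ k → 4 ≤ k → (c : Fin k → Fin n) → ¬ InducedCycle k c

  Separator : Subset n → Fin n → Fin n → Set
  Separator X u v = u ∉ X × v ∉ X × ¬ Reach X u v

  MinimalSeparator : Subset n → Fin n → Fin n → Set
  MinimalSeparator X u v = Separator X u v × (∀ Y → Y ⊂ X → ¬ Separator Y u v)

  IsClique : Subset n → Set
  IsClique K = ∀ {u v} → u ∈ K → v ∈ K → u ≢ v → Adj G u v

  IsMaxClique : Subset n → Set
  IsMaxClique K = IsClique K × (∀ K′ → IsClique K′ → K ⊆ K′ → K′ ⊆ K)

  CAdj : Subset n → Subset n → Set
  CAdj K K′ =
    IsMaxClique K × IsMaxClique K′ × K ≢ K′ ×
    (∀ u v → u ∈ K ─ K′ → v ∈ K′ ─ K → MinimalSeparator (K ∩ K′) u v)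

  weight : Subset n → Subset n → ℕ
  weight K K′ = ∣ K ∩ K′ ∣

  NonMinEdge : Subset n → Subset n → Set
  NonMinEdge K K′ = CAdj K K′ × ∃[ L ] ∃[ L′ ] (CAdj L L′ × weight L L′ < weight K K′)

  -- Two nodes lie in the same unit: connected in C(G) after deleting
  -- all edges of minimum weight.  Units are represented by any of
  -- their nodes, up to this equivalence.
  data SameUnit : Subset n → Subset n → Set where
    here : ∀ {K} → IsMaxClique K → SameUnit K K
    step : ∀ {K L K′} → NonMinEdge K L → SameUnit L K′ → SameUnit K K′

  Crosses : Subset n → Subset n → Subset n → Subset n → Set
  Crosses K K′ U U′ = CAdj K K′ × SameUnit K U × SameUnit K′ U′

  LayerAdj : Subset n → Subset n → Set
  LayerAdj U U′ = ¬ SameUnit U U′ × ∃[ K ] ∃[ K′ ] Crosses K K′ U U′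

  LayerEdgeWithLabel : Subset n → Subset n → Subset n → Set
  LayerEdgeWithLabel U U′ S =
    ¬ SameUnit U U′ × ∃[ K ] ∃[ K′ ] (Crosses K K′ U U′ × K ∩ K′ ≡ S)

  LayerPath : Subset n → Subset n → (m : ℕ) → (Fin (suc m) → Subset n) → Set
  LayerPath U U′ m W =
    (∀ i → IsMaxClique (W i)) ×
    SameUnit (W zero) U × SameUnit (W (fromℕ m)) U′ ×
    (∀ (i : Fin m) → LayerAdj (W (inject₁ i)) (W (suc i))) ×
    (∀ i j → SameUnit (W i) (W j) → i ≡ j)

{-# OPTIONS --safe #-}
module Submission where

-- The edge KK′ crossing U and U′ must have minimum weight (otherwise it
-- would lie inside a unit), so every edge of C(G) has weight at least
-- |S| where S = K ∩ K′.  Fix u ∈ K ∖ K′.  An edge of C(G) of weight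
-- above |S| has a vertex outside S in its label, so if one end meets the
-- component of u in G − S, so does the other: meeting it is constant on
-- units.  K meets it and K′ does not (S separates u from v ∈ K′ ∖ K), so
-- along the path this changes at some layer edge; the label of a crossing
-- edge there lies inside S and has at least |S| elements, so it equals S.

open import Defs
open import Data.Nat using (ℕ; suc; zero; _<_; _≤_)
open import Data.Nat.Properties using (<⇒≱; ≮⇒≥; ≤-<-trans)
open import Data.Fin using (Fin; suc; zero; inject₁; fromℕ; _≟_)
open import Data.Fin.Properties using (any?)
open import Data.Fin.Subset using (Subset; _∈_; _∉_; _⊆_; _∩_; ∣_∣)
open import Data.Fin.Subset.Properties
  using (_∈?_; ⊆-antisym; p⊂q⇒∣p∣<∣q∣; p⊆q⇒∣p∣≤∣q∣; x∈p∩q⁻; ∩-comm; x∈p∧x∉q⇒x∈p─q)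
open import Data.Product using (∃; ∃-syntax; _×_; _,_; proj₁; proj₂)
open import Data.Sum using (_⊎_; inj₁; inj₂)
open import Data.Empty using (⊥-elim)
open import Relation.Nullary using (¬_; yes; no)
open import Relation.Nullary.Decidable using (decidable-stable; ¬?; _×-dec_)
open import Relation.Binary.PropositionalEquality using (_≡_; refl; cong; subst)
  renaming (sym to ≡-sym)

module _ {n : ℕ} where

  ⊆⊎∃∈∧∉ : (p q : Subset n) → p ⊆ q ⊎ ∃ λ x → x ∈ p × x ∉ q
  ⊆⊎∃∈∧∉ p q with any? (λ x → x ∈? p ×-dec ¬? (x ∈? q))
  ... | yes witness = inj₂ witness
  ... | no none     = inj₁ λ {x} x∈p → decidable-stable (x ∈? q) (λ x∉q → none (x , x∈p , x∉q))

  ⊆∧∣∣≥⇒≡ : {p q : Subset n} → p ⊆ q → ∣ q ∣ ≤ ∣ p ∣ → p ≡ q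
  ⊆∧∣∣≥⇒≡ {p} {q} p⊆q ∣q∣≤∣p∣ with ⊆⊎∃∈∧∉ q p
  ... | inj₁ q⊆p   = ⊆-antisym p⊆q q⊆p
  ... | inj₂ x∈q∖p = ⊥-elim (<⇒≱ (p⊂q⇒∣p∣<∣q∣ (p⊆q , x∈q∖p)) ∣q∣≤∣p∣)

module _ {n : ℕ} (G : Graph n) where

  Reach-snoc : ∀ {X u w v} → Reach G X u w → Adj G w v → v ∉ X → Reach G X u v
  Reach-snoc (here w∉X)       w~v v∉X = step w∉X w~v (here v∉X)
  Reach-snoc (step u∉X u~x r) w~v v∉X = step u∉X u~x (Reach-snoc r w~v v∉X)

  Reach-sym : ∀ {X u v} → Reach G X u v → Reach G X v u
  Reach-sym (here u∉X)       = here u∉X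
  Reach-sym (step u∉X u~w r) = Reach-snoc (Reach-sym r) (Graph.sym G u~w) u∉X

  Separator-sym : ∀ {X u v} → Separator G X u v → Separator G X v u
  Separator-sym (u∉X , v∉X , ¬reach) = v∉X , u∉X , λ r → ¬reach (Reach-sym r)

  MinimalSeparator-sym : ∀ {X u v} → MinimalSeparator G X u v → MinimalSeparator G X v u
  MinimalSeparator-sym (sep , minimal) =
    Separator-sym sep , λ Y Y⊂X sepY → minimal Y Y⊂X (Separator-sym sepY)

  CAdj-sym : ∀ {K K′} → CAdj G K K′ → CAdj G K′ K
  CAdj-sym {K} {K′} (maxK , maxK′ , K≢K′ , separates) =
    maxK′ , maxK , (λ eq → K≢K′ (≡-sym eq)) , λ u v u∈K′─K v∈K─K′ →
      subst (λ X → MinimalSeparator G X u v) (∩-comm K K′)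
            (MinimalSeparator-sym (separates v u v∈K─K′ u∈K′─K))

  NonMinEdge-sym : ∀ {K K′} → NonMinEdge G K K′ → NonMinEdge G K′ K
  NonMinEdge-sym {K} {K′} (KK′ , L , L′ , LL′ , lighter) =
    CAdj-sym KK′ , L , L′ , LL′ , subst (weight G L L′ <_) (cong ∣_∣ (∩-comm K K′)) lighter

  SameUnit-trans : ∀ {A B C} → SameUnit G A B → SameUnit G B C → SameUnit G A C
  SameUnit-trans (here _)   B~C = B~C
  SameUnit-trans (step e r) B~C = step e (SameUnit-trans r B~C)

  SameUnit-sym : ∀ {A B} → SameUnit G A B → SameUnit G B A
  SameUnit-sym (here maxA) = here maxA
  SameUnit-sym (step e r)  =
    SameUnit-trans (SameUnit-sym r) (step (NonMinEdge-sym e) (here (proj₁ (proj₁ e))))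

  CAdj⇒∃∈∧∉ : ∀ {K K′} → CAdj G K K′ → ∃ λ u → u ∈ K × u ∉ K′
  CAdj⇒∃∈∧∉ {K} {K′} ((_ , maximalK) , (cliqueK′ , _) , K≢K′ , _) with ⊆⊎∃∈∧∉ K K′
  ... | inj₁ K⊆K′ = ⊥-elim (K≢K′ (⊆-antisym K⊆K′ (maximalK K′ cliqueK′ K⊆K′)))
  ... | inj₂ u    = u

  crossing-hasMinWeight : ∀ {K K′ U U′} → ¬ SameUnit G U U′ → Crosses G K K′ U U′ →
                          ∀ L L′ → CAdj G L L′ → weight G K K′ ≤ weight G L L′
  crossing-hasMinWeight U≁U′ (KK′ , K~U , K′~U′) L L′ LL′ = ≮⇒≥ λ lighter →
    U≁U′ (SameUnit-trans (SameUnit-sym K~U) (step (KK′ , L , L′ , LL′ , lighter) K′~U′))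

  CAdj-label-separates : ∀ {K K′ u v} → CAdj G K K′ → u ∈ K → u ∉ K′ → v ∈ K′ → v ∉ K →
                         Separator G (K ∩ K′) u v
  CAdj-label-separates (_ , _ , _ , separates) u∈K u∉K′ v∈K′ v∉K =
    proj₁ (separates _ _ (x∈p∧x∉q⇒x∈p─q u∈K u∉K′) (x∈p∧x∉q⇒x∈p─q v∈K′ v∉K))

  module Component (S : Subset n) (u : Fin n)
                   (S-light : ∀ L L′ → CAdj G L L′ → ∣ S ∣ ≤ weight G L L′) where

    Meets : Subset n → Set
    Meets M = ∃ λ a → a ∈ M × a ∉ S × Reach G S u a

    clique-meets⇒reach : ∀ {M a} → IsClique G M → Meets M → a ∈ M → a ∉ S → Reach G S u a
    clique-meets⇒reach {a = a} cliqueM (b , b∈M , _ , u⇝b) a∈M a∉S with b ≟ a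
    ... | yes refl = u⇝b
    ... | no b≢a   = Reach-snoc u⇝b (cliqueM b∈M a∈M b≢a) a∉S

    CAdj-label⊆⊎meets : ∀ {L L′} → CAdj G L L′ → Meets L → L ∩ L′ ⊆ S ⊎ Meets L′
    CAdj-label⊆⊎meets {L} {L′} ((cliqueL , _) , _) meetsL with ⊆⊎∃∈∧∉ (L ∩ L′) S
    ... | inj₁ label⊆S = inj₁ label⊆S
    ... | inj₂ (a , a∈L∩L′ , a∉S) =
      let (a∈L , a∈L′) = x∈p∩q⁻ L L′ a∈L∩L′
      in inj₂ (a , a∈L′ , a∉S , clique-meets⇒reach cliqueL meetsL a∈L a∉S)

    NonMinEdge-meets : ∀ {L L′} → NonMinEdge G L L′ → Meets L → Meets L′
    NonMinEdge-meets {L} {L′} (LL′ , A , B , AB , lighter) meetsL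
      with CAdj-label⊆⊎meets LL′ meetsL
    ... | inj₂ meetsL′ = meetsL′
    ... | inj₁ label⊆S =
      ⊥-elim (<⇒≱ (≤-<-trans (S-light A B AB) lighter) (p⊆q⇒∣p∣≤∣q∣ label⊆S))

    source-meets : ∀ {M} → u ∈ M → u ∉ S → Meets M
    source-meets u∈M u∉S = u , u∈M , u∉S , here u∉S

    separated-¬meets : ∀ {M v} → Separator G S u v → IsClique G M → v ∈ M → ¬ Meets M
    separated-¬meets (_ , v∉S , ¬u⇝v) cliqueM v∈M meetsM =
      ¬u⇝v (clique-meets⇒reach cliqueM meetsM v∈M v∉S)

    SameUnit-meets : ∀ {A B} → SameUnit G A B → Meets A → Meets B
    SameUnit-meets (here _)   meetsA = meetsA
    SameUnit-meets (step e r) meetsA = SameUnit-meets r (NonMinEdge-meets e meetsA)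

    layerPath-leaving⇒label : ∀ m (W : Fin (suc m) → Subset n) →
      (∀ i → LayerAdj G (W (inject₁ i)) (W (suc i))) →
      Meets (W zero) → ¬ Meets (W (fromℕ m)) →
      ∃[ i ] LayerEdgeWithLabel G (W (inject₁ i)) (W (suc i)) S
    layerPath-leaving⇒label zero    W _ meets ¬meets = ⊥-elim (¬meets meets)
    layerPath-leaving⇒label (suc m) W adj meets ¬meets
      with adj zero
    ... | W₀≁W₁ , L , L′ , (LL′ , L~W₀ , L′~W₁)
      with CAdj-label⊆⊎meets LL′ (SameUnit-meets (SameUnit-sym L~W₀) meets)
    ... | inj₁ label⊆S =
      zero , W₀≁W₁ , L , L′ , (LL′ , L~W₀ , L′~W₁) , ⊆∧∣∣≥⇒≡ label⊆S (S-light L L′ LL′)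
    ... | inj₂ meetsL′
      with layerPath-leaving⇒label m (λ i → W (suc i)) (λ i → adj (suc i))
             (SameUnit-meets L′~W₁ meetsL′) ¬meets
    ... | i , labelled = suc i , labelled

mainTheorem4 : ∀ {n : ℕ} (G : Graph n) → Connected G → Chordal G →
    (K⋆ : Subset n) → IsMaxClique G K⋆ →
    (U U′ S : Subset n) → IsMaxClique G U → IsMaxClique G U′ →
    LayerEdgeWithLabel G U U′ S →
    (m : ℕ) (W : Fin (suc m) → Subset n) → LayerPath G U U′ m W →
    ∃[ i ] LayerEdgeWithLabel G (W (inject₁ i)) (W (suc i)) S
mainTheorem4 G _ _ _ _ U U′ _ _ _
  (U≁U′ , K , K′ , crossing@(KK′ , K~U , K′~U′) , refl) m W (_ , W₀~U , Wₘ~U′ , adj , _)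
  with CAdj⇒∃∈∧∉ G KK′ | CAdj⇒∃∈∧∉ G (CAdj-sym G KK′)
... | u , u∈K , u∉K′ | v , v∈K′ , v∉K =
  layerPath-leaving⇒label m W adj
    (SameUnit-meets (SameUnit-sym G W₀~U) (SameUnit-meets K~U meetsK))
    (λ meetsWₘ → ¬meetsK′ (SameUnit-meets (SameUnit-sym G K′~U′) (SameUnit-meets Wₘ~U′ meetsWₘ)))
  where
    open Component G (K ∩ K′) u (crossing-hasMinWeight G U≁U′ crossing)

    meetsK : Meets K
    meetsK = source-meets u∈K (λ u∈K∩K′ → u∉K′ (proj₂ (x∈p∩q⁻ K K′ u∈K∩K′)))

    ¬meetsK′ : ¬ Meets K′
    ¬meetsK′ = separated-¬meets (CAdj-label-separates G KK′ u∈K u∉K′ v∈K′ v∉K)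
                                (proj₁ (proj₁ (proj₂ KK′))) v∈K′
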